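{- Let $a<b$ be real numbers, $Y=\{a,b\}$, and $X=Y^{\mathbb{N}}$. Suppose there exists a social welfare order on $X$ satisfying Upper Asymptotic Pareto and Anonymity. Then there exists a non-Ramsey collection $\Gamma\subset\Omega$.
   Context: A social welfare order on $X$ is a complete and transitive binary relation $\succsim$ on $X$; $\sim$ and $\succ$ denote its symmetric and asymmetric parts. For $x,y\in\mathbb{R}^{\mathbb{N}}$, $x\ge y$ means $x_n\ge y_n$ for all $n$. For $S\subset\mathbb{N}$, $\overline{d}(S)=\limsup_{n\to\infty}\frac{|S\cap\{1,\dots,n\}|}{n}$. Anonymity: if $x,y\in X$ and there exist $i,j\in\mathbb{N}$ with $y_j=x_i$, $x_j=y_i$, and $y_k=x_k$ for all $k\notin\{i,j\}$, then $x\sim y$. Upper Asymptotic Pareto: for $x,y\in X$, if $x\ge y$ and $x_i>y_i$ for all $i\in S$, where $S\subset\mathbb{N}$ has $\overline{d}(S)>0$, then $x\succ y$. For infinite $T\subset\mathbb{N}$, $\Omega(T)$ denotes the collection of all infinite subsets of $T$, and $\Omega=\Omega(\mathbb{N})$. A collection $\Gamma\subset\Omega$ is non-Ramsey if for every $T\in\Omega$, the collection $\Omega(T)$ intersects both $\Gamma$ and $\Omega\setminus\Gamma$. -}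

module Defs where

open import Data.Bool using (Bool; true; false)
open import Data.Nat using (ℕ; zero; suc; _+_; _*_; _≤_; _<_)
open import Data.Product using (_×_; Σ; ∃; ∃-syntax)
open import Data.Sum using (_⊎_)
open import Relation.Nullary using (¬_)
open import Relation.Binary.PropositionalEquality using (_≡_; _≢_)

-- Y = {a,b} with a < b is encoded as Bool via false ↦ a, true ↦ b
-- (an order isomorphism; all axioms only use the order on Y).
Y : Set
Y = Bool

-- X = Y^ℕ.  Coordinate n of the Agda sequence is coordinate n+1 of the paper.
X : Set
X = ℕ → Y

_≥Y_ : Y → Y → Set
u ≥Y v = v ≡ true → u ≡ true

_>Y_ : Y → Y → Set
u >Y v = (u ≡ true) × (v ≡ false)

_≥X_ : X → X → Set
x ≥X y = ∀ n → x n ≥Y y n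

Subset : Set
Subset = ℕ → Bool

_⊆_ : Subset → Subset → Set
S ⊆ T = ∀ n → S n ≡ true → T n ≡ true

Infinite : Subset → Set
Infinite S = ∀ m → ∃[ n ] (m ≤ n × S n ≡ true)

-- |S ∩ {1,…,n}|  (paper index k+1 ↔ Agda index k)
count : Subset → ℕ → ℕ
count S zero = zero
count S (suc n) with S n
... | true  = suc (count S n)
... | false = count S n

-- limsup_{n} |S ∩ {1..n}|/n > 0  ⟺  ∃ k, for infinitely many n ≥ 1,
-- |S ∩ {1..n}|/n > 1/(k+1), i.e. n < (k+1)·|S ∩ {1..n}|.
UpperDensityPos : Subset → Set
UpperDensityPos S = ∃[ k ] (∀ m → ∃[ n ] (m ≤ n × 1 ≤ n × n < suc k * count S n))

record SocialWelfareOrder (R : X → X → Set) : Set where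
  field
    complete   : ∀ x y → R x y ⊎ R y x
    transitive : ∀ {x y z} → R x y → R y z → R x z

Indiff : (X → X → Set) → X → X → Set
Indiff R x y = R x y × R y x

Strict : (X → X → Set) → X → X → Set
Strict R x y = R x y × ¬ R y x

Anonymity : (X → X → Set) → Set
Anonymity R = ∀ (x y : X) (i j : ℕ) →
  y j ≡ x i → x j ≡ y i → (∀ k → k ≢ i → k ≢ j → y k ≡ x k) →
  Indiff R x y

UpperAsymptoticPareto : (X → X → Set) → Set
UpperAsymptoticPareto R = ∀ (x y : X) (S : Subset) →
  x ≥X y → UpperDensityPos S → (∀ i → S i ≡ true → x i >Y y i) →
  Strict R x y

-- Ω(T): infinite subsets of T.  Γ ⊂ Ω is a predicate on Subset that only holds of infinite sets.
InΩ : Subset → Set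
InΩ S = Infinite S

NonRamsey : (Subset → Set) → Set
NonRamsey Γ = ∀ T → Infinite T →
  (∃[ S ] (Infinite S × S ⊆ T × Γ S)) × (∃[ S ] (Infinite S × S ⊆ T × ¬ Γ S))

-- For S ⊆ ℕ let u S be the 0/1 sequence that switches value at every element of S
-- and v S its complement; Γ consists of the infinite S with v S ≻ u S.
-- Inside a given infinite set choose a lacunary T (each element more than twice the
-- previous one) and use only subsets S ⊆ T. Then u S is constant on each run [a, b)
-- between consecutive elements of T, and every run has density above 1/2 in [0, b).
-- So u S is determined by its profile (the values on the successive runs), and when
-- one profile is pointwise ≥ another and strictly larger infinitely often, Upper
-- Asymptotic Pareto applied along those runs, with Anonymity repairing the finitely
-- many coordinates before the first run, makes the first sequence strictly better.
-- For M with profile 1000 1000 …, either u M ≿ v M, and then M ∉ Γ while the set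
-- with profile 0010 0010 … is in Γ; or v M ≿ u M, and then the sets with profiles
-- 1000 0000 … and its complement lie in Γ and outside Γ respectively.
module Submission where

open import Defs
open import Data.Bool using (Bool; true; false; not; _∧_; _∨_; _xor_; if_then_else_)
open import Data.Bool.Properties using (T-≡; xor-assoc; xor-same; xor-identityʳ)
open import Data.Empty using (⊥-elim)
open import Data.Nat using (ℕ; zero; suc; _+_; _*_; _∸_; _≤_; _<_; z≤n; s≤s; _≤ᵇ_; _≡ᵇ_; _≟_; NonZero)
open import Data.Nat.Properties
open import Data.Nat.DivMod using (_%_; _/_; m≡m%n+[m/n]*n; m%n<n; [m+kn]%n≡m%n)
open import Data.Product using (_×_; ∃-syntax; _,_; proj₁; proj₂)
open import Data.Sum using (inj₁; inj₂)
open import Function using (_∘_)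
open import Function.Bundles using (Equivalence)
open import Relation.Nullary using (¬_; yes; no)
open import Relation.Binary.PropositionalEquality

∧-true : ∀ {a b} → a ∧ b ≡ true → a ≡ true × b ≡ true
∧-true {true} {true} _ = refl , refl

≥Y-true : ∀ {u v} → u ≡ true → u ≥Y v
≥Y-true u≡true _ = u≡true

≥Y-false : ∀ {u v} → v ≡ false → u ≥Y v
≥Y-false refl ()

¬∨⇒≥Y : ∀ {u v} → not v ∨ u ≡ true → u ≥Y v
¬∨⇒≥Y h refl = h

strictlyAbove : X → X → Subset
strictlyAbove x y k = x k ∧ not (y k)

∧-not⇒>Y : ∀ {u v} → u ∧ not v ≡ true → u >Y v
∧-not⇒>Y {true} {false} _ = refl , refl

step-≤⇒mono-≤ : (f : ℕ → ℕ) → (∀ n → f n ≤ f (suc n)) → ∀ {m n} → m ≤ n → f m ≤ f n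
step-≤⇒mono-≤ f step {n = zero} z≤n = ≤-refl
step-≤⇒mono-≤ f step {n = suc n} m≤1+n with m≤n⇒m<n∨m≡n m≤1+n
... | inj₁ (s≤s m≤n) = ≤-trans (step-≤⇒mono-≤ f step m≤n) (step n)
... | inj₂ refl = ≤-refl

Gap : Subset → ℕ → ℕ → Set
Gap S m n = ∀ k → m ≤ k → k < n → S k ≡ false

Gap-empty : ∀ {S m} → Gap S m m
Gap-empty k m≤k k<m = ⊥-elim (<⇒≱ k<m m≤k)

module _ (S : Subset) where

  count-true : ∀ {n} → S n ≡ true → count S (suc n) ≡ suc (count S n)
  count-true eq rewrite eq = refl

  count-false : ∀ {n} → S n ≡ false → count S (suc n) ≡ count S n
  count-false eq rewrite eq = refl

  count-step : ∀ n → count S n ≤ count S (suc n)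
  count-step n with S n
  ... | true = n≤1+n _
  ... | false = ≤-refl

  count-mono : ∀ {m n} → m ≤ n → count S m ≤ count S n
  count-mono = step-≤⇒mono-≤ (count S) count-step

  count-< : ∀ {a b} → S a ≡ true → a < b → count S a < count S b
  count-< Sa a<b = ≤-trans (≤-reflexive (sym (count-true Sa))) (count-mono a<b)

  count-gap : ∀ {m n} → Gap S m n → m ≤ n → count S n ≡ count S m
  count-gap {n = zero} gap z≤n = refl
  count-gap {n = suc n} gap m≤1+n with m≤n⇒m<n∨m≡n m≤1+n
  ... | inj₁ (s≤s m≤n) =
    trans (count-false (gap n m≤n ≤-refl)) (count-gap (λ k m≤k k<n → gap k m≤k (m<n⇒m<1+n k<n)) m≤n)
  ... | inj₂ refl = refl

  count-run : ∀ {a} i → (∀ k → a ≤ k → k < i + a → S k ≡ true) → i ≤ count S (i + a)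
  count-run zero run = z≤n
  count-run {a} (suc i) run = begin
    suc i                  ≤⟨ s≤s (count-run i (λ k a≤k k<i+a → run k a≤k (m<n⇒m<1+n k<i+a))) ⟩
    suc (count S (i + a))  ≡⟨ count-true (run (i + a) (m≤n+m a i) ≤-refl) ⟨
    count S (suc i + a)    ∎
    where open ≤-Reasoning

  first-from : ∀ m d → S (d + m) ≡ true → ∃[ b ] (m ≤ b × S b ≡ true × Gap S m b)
  first-from m zero Sm = m , ≤-refl , Sm , Gap-empty
  first-from m (suc d) Sd+m with S m in Sm
  ... | true = m , ≤-refl , Sm , Gap-empty
  ... | false with first-from (suc m) d (subst (λ n → S n ≡ true) (sym (+-suc d m)) Sd+m)
  ...   | b , m<b , Sb , gap = b , <⇒≤ m<b , Sb , gap′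
    where
    gap′ : Gap S m b
    gap′ k m≤k k<b with m≤n⇒m<n∨m≡n m≤k
    ... | inj₁ m<k = gap k m<k k<b
    ... | inj₂ refl = Sm

  module _ (infinite : Infinite S) where

    next : ∀ m → ∃[ b ] (m ≤ b × S b ≡ true × Gap S m b)
    next m with infinite m
    ... | n , m≤n , Sn = first-from m (n ∸ m) (subst (λ k → S k ≡ true) (sym (m∸n+n≡m m≤n)) Sn)

    nth : ∀ r → ∃[ a ] (S a ≡ true × count S a ≡ r)
    nth zero with next 0
    ... | b , _ , Sb , gap = b , Sb , count-gap gap z≤n
    nth (suc r) with nth r
    ... | a , Sa , ca≡r with next (suc a)
    ...   | b , a<b , Sb , gap = b , Sb , trans (count-gap gap a<b) (trans (count-true Sa) (cong suc ca≡r))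

    nth-from : ∀ m {r} → count S m ≤ r → ∃[ a ] (m ≤ a × S a ≡ true × count S a ≡ r)
    nth-from m {r} cm≤r with nth r
    ... | a , Sa , ca≡r = a , ≮⇒≥ a≮m , Sa , ca≡r
      where
      a≮m : ¬ a < m
      a≮m a<m = <⇒≱ (count-< Sa a<m) (subst (count S m ≤_) (sym ca≡r) cm≤r)

  count-after : ∀ {a b k} → S a ≡ true → Gap S (suc a) b → a ≤ k → k < b → count S (suc k) ≡ suc (count S a)
  count-after Sa gap a≤k k<b =
    trans (count-gap (λ j a<j j<k → gap j a<j (≤-trans j<k k<b)) (s≤s a≤k)) (count-true Sa)

Thick : Subset → Set
Thick S = ∀ m → ∃[ a ] ∃[ b ] (m ≤ a × suc (a + a) ≤ b × (∀ k → a ≤ k → k < b → S k ≡ true))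

thick⇒upperDensityPos : ∀ {S} → Thick S → UpperDensityPos S
thick⇒upperDensityPos {S} thick = 1 , long-run
  where
  long-run : ∀ m → ∃[ n ] (m ≤ n × 1 ≤ n × n < 2 * count S n)
  long-run m with thick m
  ... | a , b , m≤a , 2a<b , run = b , ≤-trans m≤a a≤b , ≤-trans (s≤s z≤n) 2a<b , b<2c
    where
    a≤b : a ≤ b
    a≤b = ≤-trans (m≤m+n a (suc a)) (≤-trans (≤-reflexive (+-suc a a)) 2a<b)
    i c : ℕ
    i = b ∸ a
    c = count S b
    i+a≡b : i + a ≡ b
    i+a≡b = m∸n+n≡m a≤b
    i≤c : i ≤ c
    i≤c = subst (λ n → i ≤ count S n) i+a≡b
            (count-run S i (λ k a≤k k<i+a → run k a≤k (subst (k <_) i+a≡b k<i+a)))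
    a<i : a < i
    a<i = +-cancelʳ-≤ a (suc a) i (subst (suc (a + a) ≤_) (sym i+a≡b) 2a<b)
    b<2c : b < 2 * c
    b<2c = begin-strict
      b      ≡⟨ i+a≡b ⟨
      i + a  <⟨ +-monoʳ-< i a<i ⟩
      i + i  ≤⟨ +-mono-≤ i≤c i≤c ⟩
      c + c  ≡⟨ cong (c +_) (+-identityʳ c) ⟨
      2 * c  ∎
      where open ≤-Reasoning

record Lacunary (T : Subset) : Set where
  field
    infinite : Infinite T
    doubling : ∀ {a b} → T a ≡ true → T b ≡ true → a < b → suc (a + a) ≤ b

module _ (A : Subset) (infinite : Infinite A) where

  private
    -- threshold k is 2c+1 for the last chosen c < k: the least admissible next choice.
    threshold : ℕ → ℕ
    threshold zero = zero
    threshold (suc k) = if A k ∧ (threshold k ≤ᵇ k) then suc (k + k) else threshold k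

    chosen : Subset
    chosen k = A k ∧ (threshold k ≤ᵇ k)

    threshold≤ : ∀ {k} → chosen k ≡ true → threshold k ≤ k
    threshold≤ {k} ck = ≤ᵇ⇒≤ (threshold k) k (Equivalence.from T-≡ (proj₂ (∧-true ck)))

    threshold-chosen : ∀ {k} → chosen k ≡ true → threshold (suc k) ≡ suc (k + k)
    threshold-chosen {k} ck with chosen k
    ... | true = refl

    threshold-skipped : ∀ {k} → chosen k ≡ false → threshold (suc k) ≡ threshold k
    threshold-skipped {k} ck with chosen k
    ... | false = refl

    threshold-step : ∀ k → threshold k ≤ threshold (suc k)
    threshold-step k with chosen k in ck
    ... | true = ≤-trans (threshold≤ ck) (≤-trans (m≤m+n k k) (n≤1+n _))
    ... | false = ≤-refl

    chosen-doubling : ∀ {a b} → chosen a ≡ true → chosen b ≡ true → a < b → suc (a + a) ≤ b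
    chosen-doubling {a} {b} ca cb a<b = begin
      suc (a + a)        ≡⟨ threshold-chosen ca ⟨
      threshold (suc a)  ≤⟨ step-≤⇒mono-≤ threshold threshold-step a<b ⟩
      threshold b        ≤⟨ threshold≤ cb ⟩
      b                  ∎
      where open ≤-Reasoning

    chosen-if : ∀ {k} → A k ≡ true → threshold k ≤ k → chosen k ≡ true
    chosen-if Ak t≤k rewrite Ak = Equivalence.to T-≡ (≤⇒≤ᵇ t≤k)

    chosen-after : ∀ m d → A (d + m) ≡ true → threshold m ≤ d + m → ∃[ c ] (m ≤ c × chosen c ≡ true)
    chosen-after m zero Am t≤m = m , ≤-refl , chosen-if Am t≤m
    chosen-after m (suc d) Ad+m t≤d+m with chosen m in cm
    ... | true = m , ≤-refl , cm
    ... | false with chosen-after (suc m) d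
          (subst (λ n → A n ≡ true) (sym (+-suc d m)) Ad+m)
          (subst (threshold (suc m) ≤_) (sym (+-suc d m)) (≤-trans (≤-reflexive (threshold-skipped cm)) t≤d+m))
    ...   | c , m<c , cc = c , <⇒≤ m<c , cc

    chosen-infinite : Infinite chosen
    chosen-infinite m with infinite (threshold m + m)
    ... | n , t+m≤n , An = chosen-after m (n ∸ m)
      (subst (λ k → A k ≡ true) (sym n∸m+m≡n) An)
      (subst (threshold m ≤_) (sym n∸m+m≡n) (≤-trans (m≤m+n (threshold m) m) t+m≤n))
      where
      n∸m+m≡n : n ∸ m + m ≡ n
      n∸m+m≡n = m∸n+n≡m (≤-trans (m≤n+m m (threshold m)) t+m≤n)

  lacunary-subset : ∃[ T ] (Lacunary T × T ⊆ A)
  lacunary-subset = chosen , record { infinite = chosen-infinite ; doubling = chosen-doubling } ,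
                    λ k ck → proj₁ (∧-true ck)

Periodic : ℕ → (ℕ → Bool) → Set
Periodic d φ = ∀ s k → φ (s + k * d) ≡ φ s

residue : (d : ℕ) .{{_ : NonZero d}} → ℕ → ℕ → Bool
residue d r n = n % d ≡ᵇ r

residue-periodic : ∀ d r .{{_ : NonZero d}} → Periodic d (residue d r)
residue-periodic d r s k = cong (_≡ᵇ r) ([m+kn]%n≡m%n s k d)

module _ {d : ℕ} where

  periodic-multiple : ∀ {φ} q → Periodic d φ → Periodic (q * d) φ
  periodic-multiple {φ} q p s k = trans (cong (λ n → φ (s + n)) (sym (*-assoc k q d))) (p s (k * q))

  periodic-map : ∀ {φ} (f : Bool → Bool) → Periodic d φ → Periodic d (f ∘ φ)
  periodic-map f p s k = cong f (p s k)

  periodic-zipWith : ∀ {φ ψ} (f : Bool → Bool → Bool) → Periodic d φ → Periodic d ψ →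
                     Periodic d (λ n → f (φ n) (ψ n))
  periodic-zipWith f p q s k = cong₂ f (p s k) (q s k)

  periodic-suc : ∀ {φ} → Periodic d φ → Periodic d (φ ∘ suc)
  periodic-suc p s k = p (suc s) k

  periodic-infinite : ∀ {φ s} .{{_ : NonZero d}} → Periodic d φ → φ s ≡ true → Infinite φ
  periodic-infinite {s = s} p φs n = s + n * d , ≤-trans (m≤m*n n d) (m≤n+m (n * d) s) , trans (p s n) φs

allBelow : ℕ → (ℕ → Bool) → Bool
allBelow zero φ = true
allBelow (suc d) φ = allBelow d φ ∧ φ d

allBelow-sound : ∀ {d φ s} → allBelow d φ ≡ true → s < d → φ s ≡ true
allBelow-sound {suc d} all s<1+d with ∧-true all | m<1+n⇒m<n∨m≡n s<1+d
... | all-d , _ | inj₁ s<d = allBelow-sound all-d s<d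
... | _ , φd | inj₂ refl = φd

periodic-all : ∀ {d φ} .{{_ : NonZero d}} → Periodic d φ → allBelow d φ ≡ true → ∀ n → φ n ≡ true
periodic-all {d} {φ} p all n = begin
  φ n                        ≡⟨ cong φ (m≡m%n+[m/n]*n n d) ⟩
  φ (n % d + (n / d) * d)    ≡⟨ p (n % d) (n / d) ⟩
  φ (n % d)                  ≡⟨ allBelow-sound all (m%n<n n d) ⟩
  true                       ∎
  where open ≡-Reasoning

Dominates : (ℕ → Bool) → (ℕ → Bool) → Set
Dominates f g = (∀ n → f n ≥Y g n) × Infinite (strictlyAbove f g)

periodic-dominates : ∀ {d f g s} .{{_ : NonZero d}} → Periodic d f → Periodic d g →
                     allBelow d (λ n → not (g n) ∨ f n) ≡ true → strictlyAbove f g s ≡ true → Dominates f g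
periodic-dominates pf pg all above =
  (λ n → ¬∨⇒≥Y (periodic-all (periodic-zipWith _∨_ (periodic-map not pg) pf) all n)) ,
  periodic-infinite (periodic-zipWith (λ a b → a ∧ not b) pf pg) above

parity : Subset → ℕ → Bool
parity S zero = false
parity S (suc n) = parity S n xor S n

changes : (ℕ → Bool) → ℕ → Bool
changes F n = F n xor F (suc n)

parity-changes : ∀ F n → parity (changes F) n ≡ F 0 xor F n
parity-changes F zero = sym (xor-same (F 0))
parity-changes F (suc n) = begin
  parity (changes F) n xor (F n xor F (suc n))  ≡⟨ cong (_xor changes F n) (parity-changes F n) ⟩
  (F 0 xor F n) xor (F n xor F (suc n))          ≡⟨ xor-assoc (F 0) (F n) _ ⟩
  F 0 xor (F n xor (F n xor F (suc n)))          ≡⟨ cong (F 0 xor_) (xor-assoc (F n) (F n) _) ⟨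
  F 0 xor ((F n xor F n) xor F (suc n))          ≡⟨ cong (λ b → F 0 xor (b xor F (suc n))) (xor-same (F n)) ⟩
  F 0 xor F (suc n)                              ∎
  where open ≡-Reasoning

periodic-changes : ∀ {d F} → Periodic d F → Periodic d (changes F)
periodic-changes p = periodic-zipWith _xor_ p (periodic-suc p)

select : Subset → (ℕ → Bool) → Subset
select T φ k = T k ∧ φ (count T k)

select-⊆ : ∀ T φ → select T φ ⊆ T
select-⊆ T φ k selected = proj₁ (∧-true selected)

parity-select : ∀ T φ n → parity (select T φ) n ≡ parity φ (count T n)
parity-select T φ zero = refl
parity-select T φ (suc n) with T n
... | true = cong (_xor φ (count T n)) (parity-select T φ n)
... | false = trans (xor-identityʳ _) (parity-select T φ n)

infinite-select : ∀ {T φ} → Infinite T → Infinite φ → Infinite (select T φ)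
infinite-select {T} {φ} infT infφ m with infφ (count T m)
... | r , cm≤r , φr with nth-from T infT m cm≤r
...   | a , m≤a , Ta , ca≡r = a , m≤a , (begin
  T a ∧ φ (count T a)  ≡⟨ cong₂ (λ t n → t ∧ φ n) Ta ca≡r ⟩
  φ r                  ≡⟨ φr ⟩
  true                 ∎)
  where open ≡-Reasoning

u : Subset → X
u S k = parity S (suc k)

v : Subset → X
v S k = not (u S k)

infixr 5 _∷_
_∷_ : Bool → (ℕ → Bool) → ℕ → Bool
(b ∷ G) zero = b
(b ∷ G) (suc n) = G n

switchSet : Subset → (ℕ → Bool) → Subset
switchSet T G = select T (changes (false ∷ G))

u-switchSet : ∀ T G k → u (switchSet T G) k ≡ (false ∷ G) (count T (suc k))
u-switchSet T G k = trans (parity-select T (changes (false ∷ G)) (suc k)) (parity-changes (false ∷ G) (count T (suc k)))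

infinite-switchSet : ∀ {T G} → Infinite T → Infinite (changes G) → Infinite (switchSet T G)
infinite-switchSet {G = G} infT infG = infinite-select infT changes-shifted
  where
  changes-shifted : Infinite (changes (false ∷ G))
  changes-shifted m with infG m
  ... | n , m≤n , cn = suc n , m≤n⇒m≤1+n m≤n , cn

swap : X → ℕ → ℕ → X
swap y i j k with k ≟ i | k ≟ j
... | yes _ | _ = y j
... | no _ | yes _ = y i
... | no _ | no _ = y k

module _ (y : X) (i j : ℕ) where

  swap-at-i : swap y i j i ≡ y j
  swap-at-i with i ≟ i | i ≟ j
  ... | yes _ | _ = refl
  ... | no i≢i | _ = ⊥-elim (i≢i refl)

  swap-at-j : i ≢ j → swap y i j j ≡ y i
  swap-at-j i≢j with j ≟ i | j ≟ j
  ... | yes j≡i | _ = ⊥-elim (i≢j (sym j≡i))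
  ... | no _ | yes _ = refl
  ... | no _ | no j≢j = ⊥-elim (j≢j refl)

  swap-other : ∀ {k} → k ≢ i → k ≢ j → swap y i j k ≡ y k
  swap-other {k} k≢i k≢j with k ≟ i | k ≟ j
  ... | yes k≡i | _ = ⊥-elim (k≢i k≡i)
  ... | no _ | yes k≡j = ⊥-elim (k≢j k≡j)
  ... | no _ | no _ = refl

thick-resp : ∀ {S S′} n → (∀ k → n ≤ k → S k ≡ S′ k) → Thick S → Thick S′
thick-resp n S≡S′ thick m with thick (n + m)
... | a , b , n+m≤a , 2a<b , run = a , b , ≤-trans (m≤n+m m n) n+m≤a , 2a<b ,
  λ k a≤k k<b → trans (sym (S≡S′ k (≤-trans (m≤m+n n m) (≤-trans n+m≤a a≤k)))) (run k a≤k k<b)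

mod4≡0 mod4≡2 mod8≡0 : ℕ → Bool
mod4≡0 = residue 4 0
mod4≡2 = residue 4 2
mod8≡0 = residue 8 0

periodic-mod4≡0 : Periodic 8 mod4≡0
periodic-mod4≡0 = periodic-multiple 2 (residue-periodic 4 0)

periodic-mod4≡2 : Periodic 8 mod4≡2
periodic-mod4≡2 = periodic-multiple 2 (residue-periodic 4 2)

periodic-mod8≡0 : Periodic 8 mod8≡0
periodic-mod8≡0 = residue-periodic 8 0

changes-mod4≡0 : Infinite (changes mod4≡0)
changes-mod4≡0 = periodic-infinite {s = 0} (periodic-changes periodic-mod4≡0) refl

changes-mod4≡2 : Infinite (changes mod4≡2)
changes-mod4≡2 = periodic-infinite {s = 1} (periodic-changes periodic-mod4≡2) refl

changes-mod8≡0 : Infinite (changes mod8≡0)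
changes-mod8≡0 = periodic-infinite {s = 0} (periodic-changes periodic-mod8≡0) refl

changes-not-mod8≡0 : Infinite (changes (not ∘ mod8≡0))
changes-not-mod8≡0 = periodic-infinite {s = 0} (periodic-changes (periodic-map not periodic-mod8≡0)) refl

not-mod4≡2-dominates-mod4≡0 : Dominates (not ∘ mod4≡2) mod4≡0
not-mod4≡2-dominates-mod4≡0 = periodic-dominates {s = 1} (periodic-map not periodic-mod4≡2) periodic-mod4≡0 refl refl

not-mod4≡0-dominates-mod4≡2 : Dominates (not ∘ mod4≡0) mod4≡2
not-mod4≡0-dominates-mod4≡2 = periodic-dominates {s = 1} (periodic-map not periodic-mod4≡0) periodic-mod4≡2 refl refl

not-mod8≡0-dominates-not-mod4≡0 : Dominates (not ∘ mod8≡0) (not ∘ mod4≡0)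
not-mod8≡0-dominates-not-mod4≡0 =
  periodic-dominates {s = 4} (periodic-map not periodic-mod8≡0) (periodic-map not periodic-mod4≡0) refl refl

mod4≡0-dominates-mod8≡0 : Dominates mod4≡0 mod8≡0
mod4≡0-dominates-mod8≡0 = periodic-dominates {s = 4} periodic-mod4≡0 periodic-mod8≡0 refl refl

mod4≡0-dominates-not-not-mod8≡0 : Dominates mod4≡0 (not ∘ not ∘ mod8≡0)
mod4≡0-dominates-not-not-mod8≡0 =
  periodic-dominates {s = 4} periodic-mod4≡0 (periodic-map not (periodic-map not periodic-mod8≡0)) refl refl

module WelfareOrder (R : X → X → Set) (swo : SocialWelfareOrder R)
             (pareto : UpperAsymptoticPareto R) (anonymity : Anonymity R) where
  open SocialWelfareOrder swo

  strict-resp-indiff : ∀ {x y y′} → Strict R x y′ → Indiff R y y′ → Strict R x y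
  strict-resp-indiff (Rxy′ , ¬Ry′x) (Ryy′ , Ry′y) = transitive Rxy′ Ry′y , λ Ryx → ¬Ry′x (transitive Ry′y Ryx)

  indiff-swap : ∀ y {i j} → i ≢ j → Indiff R y (swap y i j)
  indiff-swap y {i} {j} i≢j =
    anonymity y (swap y i j) i j (swap-at-j y i j i≢j) (sym (swap-at-i y i j)) (λ k → swap-other y i j)

  strict-of-thick : ∀ {x y} → (∀ k → x k ≥Y y k) → Thick (strictlyAbove x y) → Strict R x y
  strict-of-thick {x} {y} x≥y thick =
    pareto x y (strictlyAbove x y) x≥y (thick⇒upperDensityPos thick) (λ k → ∧-not⇒>Y)

  -- Swapping y L with a coordinate a of a later run, where x a = 1 and y a = 0,
  -- makes coordinate L harmless and leaves all runs beyond a intact.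
  strict-of-eventually-≥ : ∀ {x y} L → (∀ k → L ≤ k → x k ≥Y y k) → Thick (strictlyAbove x y) → Strict R x y
  strict-of-eventually-≥ zero x≥y thick = strict-of-thick (λ k → x≥y k z≤n) thick
  strict-of-eventually-≥ {x} {y} (suc L) x≥y thick with thick (suc L)
  ... | a , b , L<a , 2a<b , run =
    strict-resp-indiff (strict-of-eventually-≥ L x≥y′ thick′) (indiff-swap y (<⇒≢ L<a))
    where
    y′ : X
    y′ = swap y L a
    xa>ya : x a >Y y a
    xa>ya = ∧-not⇒>Y (run a ≤-refl (≤-trans (s≤s (m≤m+n a a)) 2a<b))
    x≥y′ : ∀ k → L ≤ k → x k ≥Y y′ k
    x≥y′ k L≤k with m≤n⇒m<n∨m≡n L≤k
    ... | inj₂ refl = ≥Y-false (trans (swap-at-i y L a) (proj₂ xa>ya))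
    -- Deciding a ≟ k rather than k ≟ a keeps swap y L a k from being with-abstracted.
    ... | inj₁ L<k with a ≟ k
    ...   | yes refl = ≥Y-true (proj₁ xa>ya)
    ...   | no a≢k = subst (x k ≥Y_) (sym (swap-other y L a (>⇒≢ L<k) (≢-sym a≢k))) (x≥y k L<k)
    thick′ : Thick (strictlyAbove x y′)
    thick′ = thick-resp (suc a)
      (λ k a<k → cong (λ b → x k ∧ not b) (sym (swap-other y L a (>⇒≢ (<-trans L<a a<k)) (>⇒≢ a<k))))
      thick

  module _ {T : Subset} (lacunary : Lacunary T) where
    open Lacunary lacunary

    strict-of-dominates : ∀ {x y} f g → (∀ k → x k ≡ f (count T (suc k))) → (∀ k → y k ≡ g (count T (suc k))) →
                          Dominates (f ∘ suc) (g ∘ suc) → Strict R x y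
    strict-of-dominates {x} {y} f g x≡f y≡g (f≥g , often) with next T infinite 0
    ... | first , _ , T-first , _ = strict-of-eventually-≥ first eventually thick
      where
      eventually : ∀ k → first ≤ k → x k ≥Y y k
      eventually k first≤k rewrite x≡f k | y≡g k
        with count T (suc k) | ≤-trans (s≤s z≤n) (count-< T T-first (s≤s first≤k))
      ... | suc j | _ = f≥g j

      thick : Thick (strictlyAbove x y)
      thick m with often (count T m)
      ... | r , cm≤r , above with nth-from T infinite m cm≤r
      ...   | a , m≤a , Ta , ca≡r with next T infinite (suc a)
      ...     | b , a<b , Tb , gap = a , b , m≤a , doubling Ta Tb a<b , on-run
        where
        on-run : ∀ k → a ≤ k → k < b → strictlyAbove x y k ≡ true
        on-run k a≤k k<b rewrite x≡f k | y≡g k | count-after T Ta gap a≤k k<b | ca≡r = above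

  Γ : Subset → Set
  Γ S = Infinite S × ¬ R (u S) (v S)

  module _ {A T : Subset} (lacunary : Lacunary T) (T⊆A : T ⊆ A) where
    open Lacunary lacunary

    private
      S : (ℕ → Bool) → Subset
      S = switchSet T

      v-switchSet : ∀ G k → v (S G) k ≡ not ((false ∷ G) (count T (suc k)))
      v-switchSet G k = cong not (u-switchSet T G k)

    strict-uu : ∀ {G H} → Dominates G H → Strict R (u (S G)) (u (S H))
    strict-uu {G} {H} = strict-of-dominates lacunary (false ∷ G) (false ∷ H) (u-switchSet T G) (u-switchSet T H)

    strict-uv : ∀ {G H} → Dominates G (not ∘ H) → Strict R (u (S G)) (v (S H))
    strict-uv {G} {H} = strict-of-dominates lacunary (false ∷ G) (not ∘ (false ∷ H)) (u-switchSet T G) (v-switchSet H)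

    strict-vu : ∀ {G H} → Dominates (not ∘ G) H → Strict R (v (S G)) (u (S H))
    strict-vu {G} {H} = strict-of-dominates lacunary (not ∘ (false ∷ G)) (false ∷ H) (v-switchSet G) (u-switchSet T H)

    strict-vv : ∀ {G H} → Dominates (not ∘ G) (not ∘ H) → Strict R (v (S G)) (v (S H))
    strict-vv {G} {H} = strict-of-dominates lacunary (not ∘ (false ∷ G)) (not ∘ (false ∷ H)) (v-switchSet G) (v-switchSet H)

    switchSet-⊆ : ∀ G → S G ⊆ A
    switchSet-⊆ G k = T⊆A k ∘ select-⊆ T (changes (false ∷ G)) k

    member : ∀ G → Infinite (changes G) → ¬ R (u (S G)) (v (S G)) → ∃[ S′ ] (Infinite S′ × S′ ⊆ A × Γ S′)
    member G osc ¬R = S G , infinite-switchSet infinite osc , switchSet-⊆ G , infinite-switchSet infinite osc , ¬R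

    non-member : ∀ G → Infinite (changes G) → R (u (S G)) (v (S G)) → ∃[ S′ ] (Infinite S′ × S′ ⊆ A × ¬ Γ S′)
    non-member G osc Ruv = S G , infinite-switchSet infinite osc , switchSet-⊆ G , λ inΓ → proj₂ inΓ Ruv

    non-Ramsey-in : (∃[ S′ ] (Infinite S′ × S′ ⊆ A × Γ S′)) × (∃[ S′ ] (Infinite S′ × S′ ⊆ A × ¬ Γ S′))
    non-Ramsey-in with complete (u (S mod4≡0)) (v (S mod4≡0))
    ... | inj₁ uM≿vM =
      member mod4≡2 changes-mod4≡2 (λ uP≿vP → proj₂ (strict-vu not-mod4≡2-dominates-mod4≡0)
        (transitive uM≿vM (transitive (proj₁ (strict-vu not-mod4≡0-dominates-mod4≡2)) uP≿vP))) ,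
      non-member mod4≡0 changes-mod4≡0 uM≿vM
    ... | inj₂ vM≿uM =
      member mod8≡0 changes-mod8≡0 (λ uP≿vP → proj₂ (strict-uu mod4≡0-dominates-mod8≡0)
        (transitive uP≿vP (transitive (proj₁ (strict-vv not-mod8≡0-dominates-not-mod4≡0)) vM≿uM))) ,
      non-member (not ∘ mod8≡0) changes-not-mod8≡0
        (transitive (proj₁ (strict-uv not-mod8≡0-dominates-not-mod4≡0))
          (transitive vM≿uM (proj₁ (strict-uv mod4≡0-dominates-not-not-mod8≡0))))

  non-Ramsey : NonRamsey Γ
  non-Ramsey A infA with lacunary-subset A infA
  ... | T , lacunary , T⊆A = non-Ramsey-in lacunary T⊆A

proposition2 : (∃[ R ] (SocialWelfareOrder R × UpperAsymptoticPareto R × Anonymity R)) →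
    ∃[ Γ ] ((∀ S → Γ S → InΩ S) × NonRamsey Γ)
proposition2 (R , swo , pareto , anonymity) = Γ , (λ S → proj₁) , non-Ramsey
  where open WelfareOrder R swo pareto anonymity
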